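{- Let $G$ be a multigraph on at least two vertices whose underlying graph is a tree. Let $v_1,\dots,v_n$ be an ordering of $V(G)$ in which each vertex has at most one neighbor preceding it. For each $j\in[n]$ let $d_j$ be the number of edges of $G$ having $v_j$ as one endpoint and some vertex preceding $v_j$ as the other endpoint, and let $D=\max_{j\in[n]}d_j$. Then $P_{DP}(G,m)=\prod_{i=1}^n (m-d_i)$ for each $m\ge D$.
   Context: All graphs are finite, nonempty, loopless multigraphs; the underlying graph of $G$ is the simple graph obtained by removing parallel edges. For $u,v\in V(G)$, $E_G(u,v)$ is the set of edges joining $u,v$ and $e_G(u,v)=|E_G(u,v)|$. A cover of $G$ is a triple $\mathcal{H}=(L,H,M)$: $L$ assigns to each vertex a nonempty finite set, $H$ is a multigraph on $\bigcup_x L(x)$, $M$ assigns to each edge $e$ (with endpoints $u,v$) a matching $M(e)$ of $H$ whose edges go between $L(u)$ and $L(v)$, such that the $L(x)$ are pairwise disjoint, each $H[L(x)]$ is complete, $M(e_1)\cap M(e_2)=\emptyset$ for distinct edges, and for distinct $u,v$ the edges of $H$ between $L(u)$ and $L(v)$ are exactly $\bigcup_{e\in E_G(u,v)}M(e)$. It is a full $m$-fold cover if $|L(x)|=m$ for all $x$ and there are exactly $e_G(u,v)m$ edges of $H$ between $L(u)$ and $L(v)$ for all distinct $u,v$. An $\mathcal{H}$-coloring is an independent set of $H$ of size $|V(G)|$; $P_{DP}(G,\mathcal{H})$ is their number; $P_{DP}(G,m)$ is the minimum of $P_{DP}(G,\mathcal{H})$ over all full $m$-fold covers $\mathcal{H}$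 of $G$. -}

module Defs where

open import Data.Nat using (ℕ; zero; suc; _+_; _*_; _∸_; _⊔_; _≤_; _<ᵇ_; _≡ᵇ_)
open import Data.Bool using (Bool; true; false; _∧_; _∨_; not; if_then_else_)
open import Data.Fin using (Fin; zero; suc; toℕ; _≟_)
open import Data.Fin.Permutation using (Permutation′; _⟨$⟩ʳ_)
open import Data.Product using (_×_; _,_; proj₁; proj₂; Σ; ∃)
open import Data.List using (List; []; _∷_; map; concatMap; length; _∷ʳ_)
open import Data.List.Relation.Unary.Unique.Propositional using (Unique)
open import Data.List.Relation.Unary.Linked using (Linked)
open import Data.Empty using (⊥)
open import Relation.Binary.PropositionalEquality using (_≡_; _≢_)
open import Relation.Nullary using (¬_)
open import Relation.Nullary.Decidable using (⌊_⌋)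

sumF : ∀ {k} → (Fin k → ℕ) → ℕ
sumF {zero}  f = 0
sumF {suc k} f = f zero + sumF (λ i → f (suc i))

prodF : ∀ {k} → (Fin k → ℕ) → ℕ
prodF {zero}  f = 1
prodF {suc k} f = f zero * prodF (λ i → f (suc i))

maxF : ∀ {k} → (Fin k → ℕ) → ℕ
maxF {zero}  f = 0
maxF {suc k} f = f zero ⊔ maxF (λ i → f (suc i))

anyF : ∀ {k} → (Fin k → Bool) → Bool
anyF {zero}  p = false
anyF {suc k} p = p zero ∨ anyF (λ i → p (suc i))

allF : ∀ {k} → (Fin k → Bool) → Bool
allF {zero}  p = true
allF {suc k} p = p zero ∧ allF (λ i → p (suc i))

countF : ∀ {k} → (Fin k → Bool) → ℕ
countF p = sumF (λ i → if p i then 1 else 0)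

_==_ : ∀ {k} → Fin k → Fin k → Bool
i == j = ⌊ i ≟ j ⌋

-- Multigraphs: vertex set Fin n, edge set Fin k, each edge e has
-- endpoints ends e = (u , v) with u ≢ v (loopless). Parallel edges are
-- allowed (distinct edges with the same endpoints).

Ends : ℕ → ℕ → Set
Ends n k = Fin k → Fin n × Fin n

Loopless : ∀ {n k} → Ends n k → Set
Loopless ends = ∀ e → proj₁ (ends e) ≢ proj₂ (ends e)

joins : ∀ {n} → Fin n × Fin n → Fin n → Fin n → Bool
joins (a , b) u v = ((a == u) ∧ (b == v)) ∨ ((a == v) ∧ (b == u))

eG : ∀ {n k} → Ends n k → Fin n → Fin n → ℕ
eG ends u v = countF (λ e → joins (ends e) u v)

Adj : ∀ {n k} → Ends n k → Fin n → Fin n → Set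
Adj ends u v = ∃ λ e → joins (ends e) u v ≡ true

data Walk {n k} (ends : Ends n k) : Fin n → Fin n → Set where
  here : ∀ {u} → Walk ends u u
  step : ∀ {u w v} → Adj ends u w → Walk ends w v → Walk ends u v

Connected : ∀ {n k} → Ends n k → Set
Connected ends = ∀ u v → Walk ends u v

IsCycle : ∀ {n k} → Ends n k → List (Fin n) → Set
IsCycle {n} ends [] = ⊥
IsCycle {n} ends (x ∷ []) = ⊥
IsCycle {n} ends (x ∷ y ∷ []) = ⊥
IsCycle {n} ends xs@(x ∷ y ∷ z ∷ rest) =
  Unique xs × Linked (Adj ends) (xs ∷ʳ x)

Acyclic : ∀ {n k} → Ends n k → Set
Acyclic ends = ∀ xs → ¬ IsCycle ends xs

UnderlyingTree : ∀ {n k} → Ends n k → Set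
UnderlyingTree ends = Connected ends × Acyclic ends

-- L(x) = {x} × Fin m (so the L(x) are disjoint of
-- size m). H[L(x)] is complete. For each edge e of G with
-- ends e = (u , v), M e a b ≡ true means that the matching M(e) contains
-- an edge of H joining (u , a) and (v , b). The H-edges between L(u) and
-- L(v) are exactly the (pairwise distinct) edges of the M(e), e ∈ E_G(u,v).

record FullCover {n k} (ends : Ends n k) (m : ℕ) : Set where
  field
    M : Fin k → Fin m → Fin m → Bool
    matchingˡ : ∀ e a b b′ → M e a b ≡ true → M e a b′ ≡ true → b ≡ b′
    matchingʳ : ∀ e a a′ b → M e a b ≡ true → M e a′ b ≡ true → a ≡ a′
    full : ∀ u v → u ≢ v →
      sumF (λ e → if joins (ends e) u v then sumF (λ a → countF (M e a)) else 0)
        ≡ eG ends u v * m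
open FullCover public

adjH : ∀ {n k} {ends : Ends n k} {m} → FullCover ends m →
       Fin n × Fin m → Fin n × Fin m → Bool
adjH {ends = ends} C (x , a) (y , b) =
  if x == y then not (a == b)
  else anyF (λ e → (((proj₁ (ends e) == x) ∧ (proj₂ (ends e) == y)) ∧ M C e a b)
                 ∨ (((proj₁ (ends e) == y) ∧ (proj₂ (ends e) == x)) ∧ M C e b a))

VSubset : ℕ → ℕ → Set
VSubset n m = Fin n → Fin m → Bool

allFuns : ∀ {A : Set} k → List A → List (Fin k → A)
allFuns zero    xs = (λ ()) ∷ []
allFuns (suc k) xs =
  concatMap (λ a → map (λ f → λ { zero → a ; (suc i) → f i }) (allFuns k xs)) xs

allSubsets : ∀ n m → List (VSubset n m)
allSubsets n m = allFuns n (allFuns m (true ∷ false ∷ []))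

size : ∀ {n m} → VSubset n m → ℕ
size I = sumF (λ x → countF (I x))

independent : ∀ {n k} {ends : Ends n k} {m} → FullCover ends m → VSubset n m → Bool
independent C I =
  allF (λ x → allF (λ a → allF (λ y → allF (λ b →
    not (I x a ∧ I y b ∧ not ((x == y) ∧ (a == b)) ∧ adjH C (x , a) (y , b))))))

isColoring : ∀ {n k} {ends : Ends n k} {m} → FullCover ends m → VSubset n m → Bool
isColoring {n} C I = (size I ≡ᵇ n) ∧ independent C I

countList : ∀ {A : Set} → (A → Bool) → List A → ℕ
countList p [] = 0
countList p (x ∷ xs) = (if p x then 1 else 0) + countList p xs

PDPcover : ∀ {n k} {ends : Ends n k} {m} → FullCover ends m → ℕ
PDPcover {n} {m = m} C = countList (isColoring C) (allSubsets n m)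

PDPis : ∀ {n k} → Ends n k → ℕ → ℕ → Set
PDPis ends m N =
  (Σ (FullCover ends m) λ C → PDPcover C ≡ N) × (∀ (C : FullCover ends m) → N ≤ PDPcover C)

-- Orderings v_j = π ⟨$⟩ʳ j

AtMostOnePrecedingNbr : ∀ {n k} → Ends n k → Permutation′ n → Set
AtMostOnePrecedingNbr ends π = ∀ j i i′ →
  toℕ i Data.Nat.< toℕ j → toℕ i′ Data.Nat.< toℕ j →
  Adj ends (π ⟨$⟩ʳ i) (π ⟨$⟩ʳ j) → Adj ends (π ⟨$⟩ʳ i′) (π ⟨$⟩ʳ j) → i ≡ i′

dBack : ∀ {n k} → Ends n k → Permutation′ n → Fin n → ℕ
dBack ends π j = countF (λ e → anyF (λ i → (toℕ i <ᵇ toℕ j) ∧ joins (ends e) (π ⟨$⟩ʳ j) (π ⟨$⟩ʳ i)))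

-- Colour the vertices v₁, …, vₙ one at a time. Subsets of V(H) are enumerated as functions giving a
-- set of colours to each position of the ordering; counting by successive choices does not depend on
-- the order in which positions are filled, so colourings can be counted vertex by vertex along the
-- ordering. Once v₁, …, v_{j-1} are coloured, each of the d_j edges from v_j back to an earlier vertex
-- forbids, through its matching, at most one colour of v_j; so in every full m-fold cover at least
-- m − d_j colours remain at each step, and P_DP(G, H) ≥ ∏ (m − d_j).
-- For the converse take the cover in which the r-th of the parallel edges between two vertices matches
-- colours a and b iff a + b ≡ r (mod m). As v_j has a single earlier neighbour, its d_j ≤ m back edges
-- all go to that neighbour and, given its colour, forbid d_j distinct colours; so exactly m − d_j
-- colours remain at each step.

module Submission where

open import Defs
open import Algebra.Properties.CommutativeSemigroup using (interchange)
open import Data.Bool using (Bool; true; false; _∧_; _∨_; not; if_then_else_; T)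
open import Data.Bool.Properties
  using (∨-comm; ∧-conicalˡ; ∧-conicalʳ; ∧-zeroʳ; ∨-identityʳ; ∨-zeroʳ; not-injective; not-¬; T-≡; ⇔→≡)
open import Data.Empty using (⊥; ⊥-elim)
open import Data.Fin using (Fin; zero; suc; toℕ; fromℕ<)
open import Data.Fin.Permutation using (Permutation′; _⟨$⟩ʳ_; _⟨$⟩ˡ_; inverseˡ; inverseʳ)
open import Data.Fin.Properties using (_≟_; toℕ-injective; suc-injective; toℕ<n; toℕ-fromℕ<; 0≢1+n)
open import Data.List using (List; []; _∷_; map; concatMap; _++_; tabulate; allFin)
open import Data.List.Membership.Propositional using (_∈_)
open import Data.List.Membership.Propositional.Properties using (∈-allFin; ∈-map⁺)
open import Data.List.Membership.Propositional.Properties.WithK using (unique∧set⇒bag)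
open import Data.List.Relation.Binary.BagAndSetEquality using (∼bag⇒↭)
open import Data.List.Relation.Binary.Permutation.Propositional as ↭ using (_↭_)
open import Data.List.Relation.Unary.Unique.Propositional.Properties using (allFin⁺; map⁺)
open import Data.Nat using (ℕ; zero; suc; _+_; _*_; _∸_; _≤_; _<_; z≤n; s≤s; _<ᵇ_; _≡ᵇ_; _≤?_)
open import Data.Nat.DivMod using (_%_; m%n<n; m<n⇒m%n≡m)
import Data.Nat.Properties as ℕₚ
open import Data.Nat.Properties
  using (+-comm; +-assoc; +-suc; +-identityʳ; *-identityˡ; *-identityʳ; *-zeroʳ; *-distribʳ-+;
         +-commutativeSemigroup; +-cancelˡ-≡; +-cancelʳ-≡; +-cancelʳ-<; +-mono-≤; +-monoʳ-<; *-monoˡ-≤; *-monoʳ-≤;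
         ∸-monoʳ-≤; ≤-refl; ≤-reflexive; ≤-trans; ≤-antisym; <-irrefl; <-trans; <-≤-trans; ≤-<-trans; <-cmp;
         <⇒≤; <⇒≱; ≰⇒>; n≤1+n; m≤n+m; m≤m⊔n; m≤n⊔m; m∸n≤m; m+n∸m≡n; m+[n∸m]≡n; ≡ᵇ⇒≡; ≡⇒≡ᵇ; <ᵇ⇒<; <⇒<ᵇ;
         module ≤-Reasoning)
open import Data.Product using (Σ; _×_; _,_; proj₁; proj₂; ∃)
open import Data.Sum using (_⊎_; inj₁; inj₂)
open import Data.Vec.Functional using (updateAt) renaming (_∷_ to _∷ᶠ_)
open import Data.Vec.Functional.Properties
  using (updateAt-updates; updateAt-minimal; updateAt-commutes; updateAt-updateAt)
open import Function using (_∘′_)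
open import Function.Bundles using (mk⇔; module Equivalence)
open import Relation.Binary using (tri<; tri≈; tri>)
open import Relation.Binary.PropositionalEquality
open import Relation.Nullary using (¬_; yes; no; Dec; contradiction)
open import Relation.Nullary.Decidable using (dec-true; dec-false; toWitness; isYes≗does; ⌊⌋-map′)

indicator : Bool → ℕ
indicator b = if b then 1 else 0

indicator≤1 : ∀ b → indicator b ≤ 1
indicator≤1 true  = s≤s z≤n
indicator≤1 false = z≤n

indicator-*-mono : ∀ b {x y} → (b ≡ true → x ≤ y) → indicator b * x ≤ indicator b * y
indicator-*-mono true  h = *-monoʳ-≤ 1 (h refl)
indicator-*-mono false h = z≤n

∧-true⁻ : ∀ {a b} → a ∧ b ≡ true → a ≡ true × b ≡ true
∧-true⁻ {a} {b} h = ∧-conicalˡ a b h , ∧-conicalʳ a b h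

∧-true : ∀ {a b} → a ≡ true → b ≡ true → a ∧ b ≡ true
∧-true = cong₂ _∧_

<ᵇ≡true⇒< : ∀ {a b} → (a <ᵇ b) ≡ true → a < b
<ᵇ≡true⇒< {a} {b} h = <ᵇ⇒< a b (subst T (sym h) _)

<⇒<ᵇ≡true : ∀ {a b} → a < b → (a <ᵇ b) ≡ true
<⇒<ᵇ≡true a<b = Equivalence.to T-≡ (<⇒<ᵇ a<b)

<ᵇ-irrefl : ∀ a → (a <ᵇ a) ≡ false
<ᵇ-irrefl a with a <ᵇ a in h
... | false = refl
... | true  = ⊥-elim (<-irrefl refl (<ᵇ≡true⇒< {a} {a} h))

==-true : ∀ {k} {i j : Fin k} → i ≡ j → (i == j) ≡ true
==-true {i = i} {j} i≡j = trans (isYes≗does (i ≟ j)) (dec-true (i ≟ j) i≡j)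

==-refl : ∀ {k} (i : Fin k) → (i == i) ≡ true
==-refl i = ==-true refl

==-false : ∀ {k} {i j : Fin k} → i ≢ j → (i == j) ≡ false
==-false {i = i} {j} i≢j = trans (isYes≗does (i ≟ j)) (dec-false (i ≟ j) i≢j)

==⇒≡ : ∀ {k} {i j : Fin k} → (i == j) ≡ true → i ≡ j
==⇒≡ {i = i} {j} h = toWitness {a? = i ≟ j} (subst T (sym h) _)

==-sym : ∀ {k} (i j : Fin k) → (i == j) ≡ (j == i)
==-sym i j with i ≟ j
... | yes refl = sym (==-refl i)
... | no i≢j   = sym (==-false (i≢j ∘′ sym))

==-suc : ∀ {k} (i j : Fin k) → (suc i == suc j) ≡ (i == j)
==-suc i j = ⌊⌋-map′ (cong suc) suc-injective (i ≟ j)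

anyF-true : ∀ {k} {p : Fin k → Bool} i → p i ≡ true → anyF p ≡ true
anyF-true {p = p} zero    pi rewrite pi = refl
anyF-true {p = p} (suc i) pi with p zero
... | true  = refl
... | false = anyF-true {p = p ∘′ suc} i pi

anyF-true⁻ : ∀ {k} {p : Fin k → Bool} → anyF p ≡ true → ∃ λ i → p i ≡ true
anyF-true⁻ {suc k} {p} h with p zero in p0
... | true  = zero , p0
... | false = let (i , pi) = anyF-true⁻ {p = p ∘′ suc} h in suc i , pi

anyF-cong : ∀ {k} {p q : Fin k → Bool} → (∀ i → p i ≡ q i) → anyF p ≡ anyF q
anyF-cong {zero}  eq = refl
anyF-cong {suc k} eq = cong₂ _∨_ (eq zero) (anyF-cong (λ i → eq (suc i)))

allF-true : ∀ {k} {p : Fin k → Bool} → (∀ i → p i ≡ true) → allF p ≡ true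
allF-true {zero}      h = refl
allF-true {suc k} {p} h rewrite h zero = allF-true {p = p ∘′ suc} (λ i → h (suc i))

allF-true⁻ : ∀ {k} {p : Fin k → Bool} → allF p ≡ true → ∀ i → p i ≡ true
allF-true⁻ {p = p} h zero    = ∧-conicalˡ (p zero) _ h
allF-true⁻ {p = p} h (suc i) = allF-true⁻ {p = p ∘′ suc} (∧-conicalʳ (p zero) _ h) i

allF-cong : ∀ {k} {p q : Fin k → Bool} → (∀ i → p i ≡ q i) → allF p ≡ allF q
allF-cong {zero}  eq = refl
allF-cong {suc k} eq = cong₂ _∧_ (eq zero) (allF-cong (λ i → eq (suc i)))

sumF-cong : ∀ {k} {f g : Fin k → ℕ} → (∀ i → f i ≡ g i) → sumF f ≡ sumF g
sumF-cong {zero}  eq = refl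
sumF-cong {suc k} eq = cong₂ _+_ (eq zero) (sumF-cong (λ i → eq (suc i)))

sumF-mono : ∀ {k} {f g : Fin k → ℕ} → (∀ i → f i ≤ g i) → sumF f ≤ sumF g
sumF-mono {zero}  le = z≤n
sumF-mono {suc k} le = +-mono-≤ (le zero) (sumF-mono (λ i → le (suc i)))

sumF-const : ∀ {k} c → sumF {k} (λ _ → c) ≡ k * c
sumF-const {zero}  c = refl
sumF-const {suc k} c = cong (c +_) (sumF-const {k} c)

sumF-zero : ∀ {k} → sumF {k} (λ _ → 0) ≡ 0
sumF-zero {k} = trans (sumF-const {k} 0) (*-zeroʳ k)

sumF-+ : ∀ {k} (f g : Fin k → ℕ) → sumF (λ i → f i + g i) ≡ sumF f + sumF g
sumF-+ {zero}  f g = refl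
sumF-+ {suc k} f g =
  trans (cong (f zero + g zero +_) (sumF-+ (f ∘′ suc) (g ∘′ suc)))
        (interchange +-commutativeSemigroup (f zero) (g zero) _ _)

sumF-swap : ∀ {k l} (f : Fin k → Fin l → ℕ) →
  sumF (λ i → sumF (f i)) ≡ sumF (λ j → sumF (λ i → f i j))
sumF-swap {zero}  {l} f = sym (sumF-zero {l})
sumF-swap {suc k}     f =
  trans (cong (sumF (f zero) +_) (sumF-swap (f ∘′ suc)))
        (sym (sumF-+ (f zero) (λ j → sumF (λ i → f (suc i) j))))

sumF-*ʳ : ∀ {k} (f : Fin k → ℕ) c → sumF (λ i → f i * c) ≡ sumF f * c
sumF-*ʳ {zero}  f c = refl
sumF-*ʳ {suc k} f c =
  trans (cong (f zero * c +_) (sumF-*ʳ (f ∘′ suc) c)) (sym (*-distribʳ-+ c (f zero) _))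

maxF-upper : ∀ {k} (f : Fin k → ℕ) i → f i ≤ maxF f
maxF-upper f zero    = m≤m⊔n _ _
maxF-upper f (suc i) = ≤-trans (maxF-upper (f ∘′ suc) i) (m≤n⊔m _ _)

sumF-≤1-saturated : ∀ {k} (f : Fin k → ℕ) → (∀ x → f x ≤ 1) → sumF f ≡ k → ∀ x → f x ≡ 1
sumF-≤1-saturated {suc k} f ≤1 total x with f zero in f0 | ≤1 zero
... | 0 | _ = ⊥-elim (<-irrefl refl (≤-trans (≤-reflexive (sym total)) rest≤k))
  where
  rest≤k : sumF (f ∘′ suc) ≤ k
  rest≤k = ≤-trans (sumF-mono (λ i → ≤1 (suc i))) (≤-reflexive (trans (sumF-const {k} 1) (*-identityʳ k)))
... | 1 | _ = case x
  where
  case : ∀ x → f x ≡ 1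
  case zero    = f0
  case (suc x) = sumF-≤1-saturated (f ∘′ suc) (λ i → ≤1 (suc i)) (ℕₚ.suc-injective total) x
... | suc (suc _) | s≤s ()

infix 4 _⊆_

_⊆_ : ∀ {k} → (Fin k → Bool) → (Fin k → Bool) → Set
p ⊆ q = ∀ i → p i ≡ true → q i ≡ true

countF-cong : ∀ {k} {p q : Fin k → Bool} → (∀ i → p i ≡ q i) → countF p ≡ countF q
countF-cong eq = sumF-cong (λ i → cong indicator (eq i))

countF-mono : ∀ {k} {p q : Fin k → Bool} → p ⊆ q → countF p ≤ countF q
countF-mono {p = p} {q} p⊆q = sumF-mono (λ i → indicator-mono (p i) (q i) (p⊆q i))
  where
  indicator-mono : ∀ a b → (a ≡ true → b ≡ true) → indicator a ≤ indicator b
  indicator-mono false b _ = z≤n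
  indicator-mono true  b h rewrite h refl = ≤-refl

countF-strict : ∀ {k} {p q : Fin k → Bool} → p ⊆ q → ∀ x → q x ≡ true → p x ≡ false →
  countF p < countF q
countF-strict {p = p} {q} p⊆q zero qx px rewrite qx | px = s≤s (countF-mono (λ i → p⊆q (suc i)))
countF-strict {p = p} {q} p⊆q (suc x) qx px with p zero | q zero | p⊆q zero
... | false | false | _ = countF-strict (λ i → p⊆q (suc i)) x qx px
... | false | true  | _ = ≤-trans (countF-strict (λ i → p⊆q (suc i)) x qx px) (n≤1+n _)
... | true  | true  | _ = s≤s (countF-strict (λ i → p⊆q (suc i)) x qx px)
... | true  | false | h with () ← h refl

countF-complement : ∀ {k} (p : Fin k → Bool) → countF (λ i → not (p i)) ≡ k ∸ countF p
countF-complement {k} p = sym (trans (cong (_∸ countF p) (sym (partition p))) (m+n∸m≡n (countF p) _))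
  where
  partition : ∀ {k} (p : Fin k → Bool) → countF p + countF (λ i → not (p i)) ≡ k
  partition {zero}  p = refl
  partition {suc k} p with p zero | partition (p ∘′ suc)
  ... | true  | eq = cong suc eq
  ... | false | eq = trans (+-suc _ _) (cong suc eq)

countF-union : ∀ {k l} (p : Fin l → Fin k → Bool) →
  countF (λ a → anyF (λ i → p i a)) ≤ sumF (λ i → countF (p i))
countF-union p = ≤-trans (sumF-mono (λ a → indicator-any (λ i → p i a)))
                         (≤-reflexive (sumF-swap (λ a i → indicator (p i a))))
  where
  indicator-any : ∀ {l} (q : Fin l → Bool) → indicator (anyF q) ≤ countF q
  indicator-any {zero}  q = z≤n
  indicator-any {suc l} q with q zero
  ... | true  = s≤s z≤n
  ... | false = indicator-any (q ∘′ suc)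

countF-≡0 : ∀ {k} {p : Fin k → Bool} → (∀ i → p i ≡ false) → countF p ≡ 0
countF-≡0 {k} {p} none = trans (countF-cong none) (sumF-zero {k})

countF-unique : ∀ {k} (p : Fin k → Bool) → (∀ i j → p i ≡ true → p j ≡ true → i ≡ j) →
  countF p ≤ indicator (anyF p)
countF-unique {zero}  p unique = z≤n
countF-unique {suc k} p unique with p zero in p0
... | true  = s≤s (≤-reflexive (countF-≡0 λ i → rest i))
  where
  rest : ∀ i → p (suc i) ≡ false
  rest i with p (suc i) in pi
  ... | false = refl
  ... | true with () ← unique zero (suc i) p0 pi
... | false = countF-unique (p ∘′ suc) λ i j pi pj → suc-injective (unique (suc i) (suc j) pi pj)

countF≤1 : ∀ {k} (p : Fin k → Bool) → (∀ i j → p i ≡ true → p j ≡ true → i ≡ j) → countF p ≤ 1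
countF≤1 p unique = ≤-trans (countF-unique p unique) (indicator≤1 _)

countF-== : ∀ {k} (c : Fin k) → countF (λ a → a == c) ≡ 1
countF-== {suc k} zero    = cong suc (sumF-zero {k})
countF-== {suc k} (suc c) = trans (countF-cong (λ a → ==-suc a c)) (countF-== c)

==-⊆ : ∀ {k} (p : Fin k → Bool) i → p i ≡ true → (λ a → a == i) ⊆ p
==-⊆ p i pi a a==i = subst (λ x → p x ≡ true) (sym (==⇒≡ a==i)) pi

countF-member : ∀ {k} (p : Fin k → Bool) i → p i ≡ true → 1 ≤ countF p
countF-member p i pi = subst (_≤ countF p) (countF-== i) (countF-mono (==-⊆ p i pi))

countF≡0⇒false : ∀ {k} (p : Fin k → Bool) → countF p ≡ 0 → ∀ i → p i ≡ false
countF≡0⇒false p none i with p i in pi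
... | false = refl
... | true with () ← subst (1 ≤_) none (countF-member p i pi)

countF≡suc⇒∃ : ∀ {k} (p : Fin k → Bool) {r} → countF p ≡ suc r → ∃ λ i → p i ≡ true
countF≡suc⇒∃ {suc k} p eq with p zero in p0
... | true  = zero , p0
... | false = let (i , pi) = countF≡suc⇒∃ (p ∘′ suc) eq in suc i , pi

countF≡1⇒unique : ∀ {k} (p : Fin k → Bool) → countF p ≡ 1 → ∀ i j → p i ≡ true → p j ≡ true → i ≡ j
countF≡1⇒unique p one i j pi pj with i ≟ j
... | yes i≡j = i≡j
... | no  i≢j = ⊥-elim (<-irrefl refl (subst₂ _<_ (countF-== i) one
                  (countF-strict (==-⊆ p i pi) j pj
                                 (==-false (i≢j ∘′ sym)))))

countF-injection : ∀ {k l} {p : Fin k → Bool} {q : Fin l → Bool} (f : Fin k → Fin l) →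
  (∀ e → p e ≡ true → q (f e) ≡ true) →
  (∀ e e′ → p e ≡ true → p e′ ≡ true → f e ≡ f e′ → e ≡ e′) → countF p ≤ countF q
countF-injection {zero}  f maps inj = z≤n
countF-injection {suc k} {p = p} {q} f maps inj with p zero in p0
... | false = countF-injection (f ∘′ suc) (λ e → maps (suc e)) λ e e′ pe pe′ eq → suc-injective (inj _ _ pe pe′ eq)
... | true  = ≤-trans (s≤s (countF-injection {q = q′} (f ∘′ suc) maps′
                                  λ e e′ pe pe′ eq → suc-injective (inj _ _ pe pe′ eq)))
                      (countF-strict {p = q′} (λ a h → proj₁ (∧-true⁻ h)) (f zero) (maps zero p0) q′-f0)
  where
  q′ : Fin _ → Bool
  q′ a = q a ∧ not (a == f zero)
  maps′ : ∀ e → p (suc e) ≡ true → q′ (f (suc e)) ≡ true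
  maps′ e pe = ∧-true (maps (suc e) pe) (cong not (==-false λ eq → 0≢1+n (sym (inj (suc e) zero pe p0 eq))))
  q′-f0 : q′ (f zero) ≡ false
  q′-f0 rewrite ==-refl (f zero) = ∧-zeroʳ (q (f zero))

sumL : ∀ {A : Set} → List A → (A → ℕ) → ℕ
sumL []       f = 0
sumL (x ∷ xs) f = f x + sumL xs f

sumL-cong : ∀ {A : Set} (xs : List A) {f g : A → ℕ} → (∀ a → f a ≡ g a) → sumL xs f ≡ sumL xs g
sumL-cong []       eq = refl
sumL-cong (x ∷ xs) eq = cong₂ _+_ (eq x) (sumL-cong xs eq)

sumL-mono : ∀ {A : Set} (xs : List A) {f g : A → ℕ} → (∀ a → f a ≤ g a) → sumL xs f ≤ sumL xs g
sumL-mono []       le = z≤n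
sumL-mono (x ∷ xs) le = +-mono-≤ (le x) (sumL-mono xs le)

sumL-zero : ∀ {A : Set} (xs : List A) → sumL xs (λ _ → 0) ≡ 0
sumL-zero []       = refl
sumL-zero (x ∷ xs) = sumL-zero xs

sumL-+ : ∀ {A : Set} (xs : List A) (f g : A → ℕ) → sumL xs (λ a → f a + g a) ≡ sumL xs f + sumL xs g
sumL-+ []       f g = refl
sumL-+ (x ∷ xs) f g =
  trans (cong (f x + g x +_) (sumL-+ xs f g)) (interchange +-commutativeSemigroup (f x) (g x) _ _)

sumL-swap : ∀ {A B : Set} (xs : List A) (ys : List B) (h : A → B → ℕ) →
  sumL xs (λ a → sumL ys (h a)) ≡ sumL ys (λ b → sumL xs (λ a → h a b))
sumL-swap []       ys h = sym (sumL-zero ys)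
sumL-swap (x ∷ xs) ys h =
  trans (cong (sumL ys (h x) +_) (sumL-swap xs ys h)) (sym (sumL-+ ys (h x) (λ b → sumL xs (λ a → h a b))))

sumL-*ʳ : ∀ {A : Set} (xs : List A) (f : A → ℕ) c → sumL xs (λ a → f a * c) ≡ sumL xs f * c
sumL-*ʳ []       f c = refl
sumL-*ʳ (x ∷ xs) f c = trans (cong (f x * c +_) (sumL-*ʳ xs f c)) (sym (*-distribʳ-+ c (f x) _))

countList≡sumL : ∀ {A : Set} (P : A → Bool) xs → countList P xs ≡ sumL xs (λ a → indicator (P a))
countList≡sumL P []       = refl
countList≡sumL P (x ∷ xs) = cong (indicator (P x) +_) (countList≡sumL P xs)

countList-cong : ∀ {A : Set} {P Q : A → Bool} xs → (∀ a → P a ≡ Q a) → countList P xs ≡ countList Q xs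
countList-cong []       eq = refl
countList-cong (x ∷ xs) eq = cong₂ _+_ (cong indicator (eq x)) (countList-cong xs eq)

countList-∧ : ∀ {A : Set} b (R : A → Bool) xs → countList (λ a → b ∧ R a) xs ≡ indicator b * countList R xs
countList-∧ true  R xs       = sym (+-identityʳ _)
countList-∧ false R []       = refl
countList-∧ false R (x ∷ xs) = countList-∧ false R xs

countList-++ : ∀ {A : Set} (P : A → Bool) xs ys → countList P (xs ++ ys) ≡ countList P xs + countList P ys
countList-++ P []       ys = refl
countList-++ P (x ∷ xs) ys = trans (cong (indicator (P x) +_) (countList-++ P xs ys)) (sym (+-assoc (indicator (P x)) _ _))

countList-map : ∀ {A B : Set} (P : B → Bool) (f : A → B) xs → countList P (map f xs) ≡ countList (λ a → P (f a)) xs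
countList-map P f []       = refl
countList-map P f (x ∷ xs) = cong (indicator (P (f x)) +_) (countList-map P f xs)

countList-concatMap : ∀ {A B : Set} (P : B → Bool) (F : A → List B) xs →
  countList P (concatMap F xs) ≡ sumL xs (λ a → countList P (F a))
countList-concatMap P F []       = refl
countList-concatMap P F (x ∷ xs) =
  trans (countList-++ P (F x) (concatMap F xs)) (cong (countList P (F x) +_) (countList-concatMap P F xs))

module Enumeration {A : Set} (a₀ : A) (xs : List A) where

  Extensional : ∀ {n} → ((Fin n → A) → Bool) → Set
  Extensional P = ∀ g g′ → (∀ i → g i ≡ g′ i) → P g ≡ P g′

  Extensional-∷ : ∀ {n} {P : (Fin (suc n) → A) → Bool} → Extensional P → ∀ a → Extensional (λ g → P (a ∷ᶠ g))
  Extensional-∷ ext a g g′ eq = ext _ _ λ { zero → refl ; (suc i) → eq i }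

  countList-allFuns-suc : ∀ {n} (P : (Fin (suc n) → A) → Bool) → Extensional P →
    countList P (allFuns (suc n) xs) ≡ sumL xs (λ a → countList (λ g → P (a ∷ᶠ g)) (allFuns n xs))
  countList-allFuns-suc {n} P ext = trans (countList-concatMap P _ xs) (sumL-cong xs λ a →
    trans (countList-map P _ (allFuns n xs)) (countList-cong (allFuns n xs) λ g →
      ext _ _ λ { zero → refl ; (suc i) → refl }))

  set : ∀ {n} → (Fin n → A) → Fin n → A → Fin n → A
  set f x a = updateAt f x (λ _ → a)

  set-cong : ∀ {n} {f f′ : Fin n → A} x a → (∀ i → f i ≡ f′ i) → ∀ i → set f x a i ≡ set f′ x a i
  set-cong {f = f} {f′} x a eq i with i ≟ x
  ... | yes refl = trans (updateAt-updates i f) (sym (updateAt-updates i f′))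
  ... | no  i≢x  = trans (updateAt-minimal i x f i≢x) (trans (eq i) (sym (updateAt-minimal i x f′ i≢x)))

  fillings : ∀ {n} → (Fin n → A) → List (Fin n) → ((Fin n → A) → Bool) → ℕ
  fillings f []      P = indicator (P f)
  fillings f (x ∷ L) P = sumL xs (λ a → fillings (set f x a) L P)

  fillings-cong : ∀ {n} {P : (Fin n → A) → Bool} → Extensional P → ∀ L {f f′ : Fin n → A} →
    (∀ i → f i ≡ f′ i) → fillings f L P ≡ fillings f′ L P
  fillings-cong ext []      eq = cong indicator (ext _ _ eq)
  fillings-cong ext (x ∷ L) eq = sumL-cong xs λ a → fillings-cong ext L (set-cong x a eq)

  fillings-↭ : ∀ {n} {P : (Fin n → A) → Bool} → Extensional P → ∀ {L L′} → L ↭ L′ → ∀ f →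
    fillings f L P ≡ fillings f L′ P
  fillings-↭ ext ↭.refl        f = refl
  fillings-↭ ext (↭.prep x p)  f = sumL-cong xs λ a → fillings-↭ ext p (set f x a)
  fillings-↭ ext (↭.trans p q) f = trans (fillings-↭ ext p f) (fillings-↭ ext q f)
  fillings-↭ {P = P} ext {x ∷ y ∷ L} {_ ∷ _ ∷ L′} (↭.swap x y p) f with x ≟ y
  ... | yes refl = sumL-cong xs λ a → sumL-cong xs λ b →
    trans (fillings-cong ext L (updateAt-updateAt x f))
          (trans (fillings-↭ ext p (set f x b)) (sym (fillings-cong ext L′ (updateAt-updateAt x f))))
  ... | no x≢y = begin
    sumL xs (λ a → sumL xs (λ b → fillings (set (set f x a) y b) L P))
      ≡⟨ sumL-cong xs (λ a → sumL-cong xs λ b → fillings-cong ext L (updateAt-commutes y x (x≢y ∘′ sym) f)) ⟩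
    sumL xs (λ a → sumL xs (λ b → fillings (set (set f y b) x a) L P))
      ≡⟨ sumL-swap xs xs _ ⟩
    sumL xs (λ b → sumL xs (λ a → fillings (set (set f y b) x a) L P))
      ≡⟨ sumL-cong xs (λ b → sumL-cong xs λ a → fillings-↭ ext p _) ⟩
    sumL xs (λ b → sumL xs (λ a → fillings (set (set f y b) x a) L′ P)) ∎
    where open ≡-Reasoning

  fillings-tabulate-suc : ∀ {n k} (h : Fin k → Fin n) (f : Fin (suc n) → A) (P : (Fin (suc n) → A) → Bool) →
    Extensional P →
    fillings f (tabulate (λ i → suc (h i))) P ≡ fillings (λ i → f (suc i)) (tabulate h) (λ g → P (f zero ∷ᶠ g))
  fillings-tabulate-suc {k = zero}  h f P ext = cong indicator (ext _ _ λ { zero → refl ; (suc i) → refl })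
  fillings-tabulate-suc {k = suc k} h f P ext =
    sumL-cong xs λ a → fillings-tabulate-suc (h ∘′ suc) (set f (suc (h zero)) a) P ext

  fillings-allFin : ∀ {n} (f : Fin n → A) (P : (Fin n → A) → Bool) → Extensional P →
    fillings f (allFin n) P ≡ countList P (allFuns n xs)
  fillings-allFin {zero}  f P ext = trans (cong indicator (ext _ _ λ ())) (sym (+-identityʳ _))
  fillings-allFin {suc n} f P ext =
    trans (sumL-cong xs λ a → trans (fillings-tabulate-suc (λ i → i) (set f zero a) P ext)
                                    (fillings-allFin _ (λ g → P (a ∷ᶠ g)) (Extensional-∷ ext a)))
          (sym (countList-allFuns-suc P ext))

  module _ {n} (π : Permutation′ n) where

    private
      σ τ : Fin n → Fin n
      σ = π ⟨$⟩ʳ_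
      τ = π ⟨$⟩ˡ_

      σ-injective : ∀ {i j} → σ i ≡ σ j → i ≡ j
      σ-injective {i} {j} eq = trans (sym (inverseˡ π)) (trans (cong τ eq) (inverseˡ π))

    fillings-map-permute : ∀ (P : (Fin n → A) → Bool) → Extensional P → ∀ L f →
      fillings f (map σ L) P ≡ fillings (λ i → f (σ i)) L (λ g → P (λ y → g (τ y)))
    fillings-map-permute P ext []      f = cong indicator (ext _ _ λ y → cong f (sym (inverseʳ π)))
    fillings-map-permute P ext (x ∷ L) f = sumL-cong xs λ a →
      trans (fillings-map-permute P ext L (set f (σ x) a))
            (fillings-cong (λ g g′ eq → ext _ _ (λ y → eq (τ y))) L (set-σ a))
      where
      set-σ : ∀ a i → set f (σ x) a (σ i) ≡ set (λ i → f (σ i)) x a i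
      set-σ a i with i ≟ x
      ... | yes refl = trans (updateAt-updates (σ i) f) (sym (updateAt-updates i (λ i → f (σ i))))
      ... | no  i≢x  = trans (updateAt-minimal (σ i) (σ x) f (i≢x ∘′ σ-injective))
                             (sym (updateAt-minimal i x (λ i → f (σ i)) i≢x))

    map-permute-allFin-↭ : map σ (allFin n) ↭ allFin n
    map-permute-allFin-↭ = ∼bag⇒↭ (unique∧set⇒bag (map⁺ σ-injective (allFin⁺ n)) (allFin⁺ n)
      λ {y} → mk⇔ (λ _ → ∈-allFin y)
                  (λ _ → subst (_∈ map σ (allFin n)) (inverseʳ π) (∈-map⁺ σ (∈-allFin (τ y)))))

    countList-allFuns-permute : ∀ (P : (Fin n → A) → Bool) → Extensional P →
      countList P (allFuns n xs) ≡ countList (λ g → P (λ y → g (τ y))) (allFuns n xs)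
    countList-allFuns-permute P ext = begin
      countList P (allFuns n xs)                             ≡⟨ fillings-allFin f₀ P ext ⟨
      fillings f₀ (allFin n) P                                ≡⟨ fillings-↭ ext map-permute-allFin-↭ f₀ ⟨
      fillings f₀ (map σ (allFin n)) P                        ≡⟨ fillings-map-permute P ext (allFin n) f₀ ⟩
      fillings (λ i → f₀ (σ i)) (allFin n) (λ g → P (λ y → g (τ y)))
        ≡⟨ fillings-allFin _ _ (λ g g′ eq → ext _ _ λ y → eq (τ y)) ⟩
      countList (λ g → P (λ y → g (τ y))) (allFuns n xs)      ∎
      where
      open ≡-Reasoning
      f₀ : Fin n → A
      f₀ _ = a₀

  DependsOnPrefix : ∀ {n} → (Fin n → (Fin n → A) → Bool) → Set
  DependsOnPrefix Q = ∀ j g g′ → (∀ i → toℕ i ≤ toℕ j → g i ≡ g′ i) → Q j g ≡ Q j g′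

  EarlierHold : ∀ {n} → (Fin n → (Fin n → A) → Bool) → Fin n → (Fin n → A) → Set
  EarlierHold Q j g = ∀ i → toℕ i < toℕ j → Q i g ≡ true

  allHold : ∀ {n} → (Fin n → (Fin n → A) → Bool) → (Fin n → A) → Bool
  allHold Q g = allF (λ j → Q j g)

  choicesAt : ∀ {n} → (Fin n → (Fin n → A) → Bool) → Fin n → (Fin n → A) → ℕ
  choicesAt Q j g = countList (λ a → Q j (set g j a)) xs

  module _ {n} (Q : Fin (suc n) → (Fin (suc n) → A) → Bool) (dep : DependsOnPrefix Q) where

    afterHead : A → Fin n → (Fin n → A) → Bool
    afterHead a j g = Q (suc j) (a ∷ᶠ g)

    afterHead-dependsOnPrefix : ∀ a → DependsOnPrefix (afterHead a)
    afterHead-dependsOnPrefix a j g g′ eq = dep (suc j) _ _ λ { zero _ → refl ; (suc i) (s≤s i≤j) → eq i i≤j }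

    head-constraint : ∀ a (g : Fin (suc n) → A) → g zero ≡ a → Q zero g ≡ Q zero (λ _ → a)
    head-constraint a g eq = dep zero _ _ λ { zero _ → eq ; (suc i) () }

    choicesAt-afterHead : ∀ a j g → choicesAt (afterHead a) j g ≡ choicesAt Q (suc j) (a ∷ᶠ g)
    choicesAt-afterHead a j g = countList-cong xs λ b → dep (suc j) _ _ λ { zero _ → refl ; (suc i) _ → refl }

    earlierHold-afterHead : ∀ a j g → Q zero (λ _ → a) ≡ true → EarlierHold (afterHead a) j g →
      EarlierHold Q (suc j) (a ∷ᶠ g)
    earlierHold-afterHead a j g q₀ earlier zero    _         = trans (head-constraint a _ refl) q₀
    earlierHold-afterHead a j g q₀ earlier (suc i) (s≤s i<j) = earlier i i<j

    countList-allHold-suc : countList (allHold Q) (allFuns (suc n) xs) ≡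
      sumL xs (λ a → indicator (Q zero (λ _ → a)) * countList (allHold (afterHead a)) (allFuns n xs))
    countList-allHold-suc = trans (countList-allFuns-suc (allHold Q) allHold-extensional) (sumL-cong xs λ a →
      trans (countList-cong (allFuns n xs) (λ g → cong (_∧ allHold (afterHead a) g) (head-constraint a _ refl)))
            (countList-∧ (Q zero (λ _ → a)) _ (allFuns n xs)))
      where
      allHold-extensional : Extensional (allHold Q)
      allHold-extensional g g′ eq = allF-cong λ j → dep j g g′ (λ i _ → eq i)

    choicesAt-zero : ∀ g → choicesAt Q zero g ≡ countList (λ a → Q zero (λ _ → a)) xs
    choicesAt-zero g = countList-cong xs λ a → head-constraint a _ refl

    sumL-indicator-head : ∀ c →
      countList (λ a → Q zero (λ _ → a)) xs * c ≡ sumL xs (λ a → indicator (Q zero (λ _ → a)) * c)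
    sumL-indicator-head c = trans (cong (_* c) (countList≡sumL _ xs)) (sym (sumL-*ʳ xs _ c))

  prod≤countList-allHold : ∀ {n} (Q : Fin n → (Fin n → A) → Bool) (r : Fin n → ℕ) → DependsOnPrefix Q →
    (∀ j g → EarlierHold Q j g → r j ≤ choicesAt Q j g) → prodF r ≤ countList (allHold Q) (allFuns n xs)
  prod≤countList-allHold {zero}  Q r dep choices = ≤-refl
  prod≤countList-allHold {suc n} Q r dep choices = begin
    r zero * prodF (r ∘′ suc)
      ≤⟨ *-monoˡ-≤ _ (≤-trans (choices zero (λ _ → a₀) (λ _ ())) (≤-reflexive (choicesAt-zero Q dep _))) ⟩
    countList (λ a → Q zero (λ _ → a)) xs * prodF (r ∘′ suc)
      ≡⟨ sumL-indicator-head Q dep _ ⟩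
    sumL xs (λ a → indicator (Q zero (λ _ → a)) * prodF (r ∘′ suc))
      ≤⟨ sumL-mono xs (λ a → indicator-*-mono (Q zero (λ _ → a)) λ q₀ →
           prod≤countList-allHold (afterHead Q dep a) (r ∘′ suc) (afterHead-dependsOnPrefix Q dep a) λ j g earlier →
             ≤-trans (choices (suc j) _ (earlierHold-afterHead Q dep a j g q₀ earlier))
                     (≤-reflexive (sym (choicesAt-afterHead Q dep a j g)))) ⟩
    sumL xs (λ a → indicator (Q zero (λ _ → a)) * countList (allHold (afterHead Q dep a)) (allFuns n xs))
      ≡⟨ countList-allHold-suc Q dep ⟨
    countList (allHold Q) (allFuns (suc n) xs) ∎
    where open ≤-Reasoning

  countList-allHold≤prod : ∀ {n} (Q : Fin n → (Fin n → A) → Bool) (r : Fin n → ℕ) → DependsOnPrefix Q →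
    (∀ j g → EarlierHold Q j g → choicesAt Q j g ≤ r j) → countList (allHold Q) (allFuns n xs) ≤ prodF r
  countList-allHold≤prod {zero}  Q r dep choices = ≤-refl
  countList-allHold≤prod {suc n} Q r dep choices = begin
    countList (allHold Q) (allFuns (suc n) xs)
      ≡⟨ countList-allHold-suc Q dep ⟩
    sumL xs (λ a → indicator (Q zero (λ _ → a)) * countList (allHold (afterHead Q dep a)) (allFuns n xs))
      ≤⟨ sumL-mono xs (λ a → indicator-*-mono (Q zero (λ _ → a)) λ q₀ →
           countList-allHold≤prod (afterHead Q dep a) (r ∘′ suc) (afterHead-dependsOnPrefix Q dep a) λ j g earlier →
             ≤-trans (≤-reflexive (choicesAt-afterHead Q dep a j g))
                     (choices (suc j) _ (earlierHold-afterHead Q dep a j g q₀ earlier))) ⟩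
    sumL xs (λ a → indicator (Q zero (λ _ → a)) * prodF (r ∘′ suc))
      ≡⟨ sumL-indicator-head Q dep _ ⟨
    countList (λ a → Q zero (λ _ → a)) xs * prodF (r ∘′ suc)
      ≤⟨ *-monoˡ-≤ _ (≤-trans (≤-reflexive (sym (choicesAt-zero Q dep _))) (choices zero (λ _ → a₀) (λ _ ()))) ⟩
    r zero * prodF (r ∘′ suc) ∎
    where open ≤-Reasoning

bools : List Bool
bools = true ∷ false ∷ []

isEmpty : ∀ {m} → (Fin m → Bool) → Bool
isEmpty S = allF (λ a → not (S a))

singletonIn : ∀ {m} → (Fin m → Bool) → (Fin m → Bool) → Bool
singletonIn {zero}  S h = false
singletonIn {suc m} S h = if S zero then h zero ∧ isEmpty (S ∘′ suc) else singletonIn (S ∘′ suc) (h ∘′ suc)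

isEmpty-sound : ∀ {m} (S : Fin m → Bool) → isEmpty S ≡ true → countF S ≡ 0
isEmpty-sound S h = countF-≡0 {p = S} λ a → not-injective (allF-true⁻ {p = λ a → not (S a)} h a)

isEmpty-complete : ∀ {m} (S : Fin m → Bool) → countF S ≡ 0 → isEmpty S ≡ true
isEmpty-complete S none = allF-true λ a → cong not (countF≡0⇒false S none a)

singletonIn-sound : ∀ {m} (S h : Fin m → Bool) → singletonIn S h ≡ true → countF S ≡ 1 × S ⊆ h
singletonIn-sound {suc m} S h e with S zero in s0
... | true  = cong suc (isEmpty-sound (S ∘′ suc) rest-empty) , λ
  { zero    _  → ∧-conicalˡ (h zero) _ e
  ; (suc a) Sa → contradiction Sa (not-¬ (countF≡0⇒false (S ∘′ suc) (isEmpty-sound (S ∘′ suc) rest-empty) a)) }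
  where
  rest-empty : isEmpty (S ∘′ suc) ≡ true
  rest-empty = ∧-conicalʳ (h zero) _ e
... | false = let (one , S⊆h) = singletonIn-sound (S ∘′ suc) (h ∘′ suc) e in one , λ
  { zero    S0 → contradiction S0 (not-¬ s0)
  ; (suc a) Sa → S⊆h a Sa }

singletonIn-complete : ∀ {m} (S h : Fin m → Bool) → countF S ≡ 1 → S ⊆ h → singletonIn S h ≡ true
singletonIn-complete {suc m} S h one S⊆h with S zero in s0
... | true  = ∧-true (S⊆h zero s0) (isEmpty-complete (S ∘′ suc) (ℕₚ.suc-injective one))
... | false = singletonIn-complete (S ∘′ suc) (h ∘′ suc) one (λ a → S⊆h (suc a))

singletonIn-cong : ∀ {m} {S S′ h h′ : Fin m → Bool} → (∀ a → S a ≡ S′ a) → (∀ a → h a ≡ h′ a) →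
  singletonIn S h ≡ singletonIn S′ h′
singletonIn-cong {zero}  eqS eqh = refl
singletonIn-cong {suc m} {S} {S′} eqS eqh rewrite eqS zero with S′ zero
... | true  = cong₂ _∧_ (eqh zero) (allF-cong λ a → cong not (eqS (suc a)))
... | false = singletonIn-cong (λ a → eqS (suc a)) (λ a → eqh (suc a))

countList-isEmpty : ∀ m → countList isEmpty (allFuns m bools) ≡ 1
countList-isEmpty zero    = refl
countList-isEmpty (suc m) =
  trans (Enumeration.countList-allFuns-suc false bools {n = m} isEmpty λ S S′ eq → allF-cong λ a → cong not (eq a))
        (cong₂ (λ x y → x + (y + 0)) (countList-∧ false isEmpty (allFuns m bools))
                                     (countList-isEmpty m))

countList-singletonIn : ∀ m (h : Fin m → Bool) → countList (λ S → singletonIn S h) (allFuns m bools) ≡ countF h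
countList-singletonIn zero    h = refl
countList-singletonIn (suc m) h =
  trans (Enumeration.countList-allFuns-suc false bools {n = m} (λ S → singletonIn S h)
                                            λ S S′ eq → singletonIn-cong {h = h} eq λ _ → refl)
        (cong₂ _+_ (trans (countList-∧ (h zero) isEmpty (allFuns m bools))
                          (trans (cong (indicator (h zero) *_) (countList-isEmpty m)) (*-identityʳ _)))
                   (trans (+-identityʳ _) (countList-singletonIn m (h ∘′ suc))))

joins-cases : ∀ {n} (p : Fin n × Fin n) u w → joins p u w ≡ true →
  (proj₁ p ≡ u × proj₂ p ≡ w) ⊎ (proj₁ p ≡ w × proj₂ p ≡ u)
joins-cases (p₁ , p₂) u w h with (p₁ == u) ∧ (p₂ == w) in forward
... | true  = inj₁ (==⇒≡ (∧-conicalˡ _ _ forward) , ==⇒≡ (∧-conicalʳ (p₁ == u) _ forward))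
... | false = inj₂ (==⇒≡ (∧-conicalˡ _ _ h) , ==⇒≡ (∧-conicalʳ (p₁ == w) _ h))

joins-sym : ∀ {n} (p : Fin n × Fin n) u w → joins p u w ≡ joins p w u
joins-sym (p₁ , p₂) u w = ∨-comm ((p₁ == u) ∧ (p₂ == w)) ((p₁ == w) ∧ (p₂ == u))

joins-endpoints : ∀ {n} (q p : Fin n × Fin n) x y → joins p x y ≡ true → joins q (proj₁ p) (proj₂ p) ≡ joins q x y
joins-endpoints q p x y h with joins-cases p x y h
... | inj₁ (refl , refl) = refl
... | inj₂ (refl , refl) = joins-sym q _ _

joins-other-end-unique : ∀ {n} (p : Fin n × Fin n) u w w′ → joins p u w ≡ true → joins p u w′ ≡ true →
  u ≢ w → u ≢ w′ → w ≡ w′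
joins-other-end-unique p u w w′ j j′ u≢w u≢w′ with joins-cases p u w j | joins-cases p u w′ j′
... | inj₁ (_ , p₂≡w) | inj₁ (_ , p₂≡w′) = trans (sym p₂≡w) p₂≡w′
... | inj₁ (p₁≡u , _) | inj₂ (p₁≡w′ , _) = ⊥-elim (u≢w′ (trans (sym p₁≡u) p₁≡w′))
... | inj₂ (p₁≡w , _) | inj₁ (p₁≡u , _)  = ⊥-elim (u≢w (trans (sym p₁≡u) p₁≡w))
... | inj₂ (p₁≡w , _) | inj₂ (p₁≡w′ , _) = trans (sym p₁≡w) p₁≡w′

module _ {n k} {ends : Ends n k} {m} (C : FullCover ends m) where

  adjH-sym : ∀ x a y b → adjH C (x , a) (y , b) ≡ adjH C (y , b) (x , a)
  adjH-sym x a y b rewrite ==-sym x y with y == x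
  ... | true  = cong not (==-sym a b)
  ... | false = anyF-cong λ e →
    ∨-comm (((proj₁ (ends e) == x) ∧ (proj₂ (ends e) == y)) ∧ M C e a b)
           (((proj₁ (ends e) == y) ∧ (proj₂ (ends e) == x)) ∧ M C e b a)

  adjH-same-vertex : ∀ x {a b} → a ≢ b → adjH C (x , a) (x , b) ≡ true
  adjH-same-vertex x a≢b rewrite ==-refl x | ==-false a≢b = refl

  adjH-neighbours≤eG : ∀ {x y} → x ≢ y → ∀ b → countF (λ a → adjH C (x , a) (y , b)) ≤ eG ends x y
  adjH-neighbours≤eG {x} {y} x≢y b rewrite ==-false x≢y =
    ≤-trans (countF-union (λ e a → forward e ∧ M C e a b ∨ backward e ∧ M C e b a))
            (sumF-mono λ e → per-edge (forward e) (backward e) (not-both e)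
                               (λ a a′ → matchingʳ C e a a′ b) (λ a a′ → matchingˡ C e b a a′))
    where
    forward backward : Fin k → Bool
    forward  e = (proj₁ (ends e) == x) ∧ (proj₂ (ends e) == y)
    backward e = (proj₁ (ends e) == y) ∧ (proj₂ (ends e) == x)
    not-both : ∀ e → forward e ≡ true → backward e ≡ true → ⊥
    not-both e f b = x≢y (trans (sym (==⇒≡ {i = proj₁ (ends e)} (proj₁ (∧-true⁻ f))))
                                (==⇒≡ {i = proj₁ (ends e)} (proj₁ (∧-true⁻ b))))
    per-edge : ∀ o₁ o₂ {M₁ M₂ : Fin m → Bool} → (o₁ ≡ true → o₂ ≡ true → ⊥) →
      (∀ a a′ → M₁ a ≡ true → M₁ a′ ≡ true → a ≡ a′) →
      (∀ a a′ → M₂ a ≡ true → M₂ a′ ≡ true → a ≡ a′) →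
      countF (λ a → o₁ ∧ M₁ a ∨ o₂ ∧ M₂ a) ≤ indicator (o₁ ∨ o₂)
    per-edge true  true  both u₁ u₂ = ⊥-elim (both refl refl)
    per-edge true  false {M₁} both u₁ u₂ =
      subst (_≤ 1) (countF-cong λ a → sym (∨-identityʳ (M₁ a))) (countF≤1 M₁ u₁)
    per-edge false true  both u₁ u₂ = countF≤1 _ u₂
    per-edge false false both u₁ u₂ = ≤-reflexive (sumF-zero {m})

  DistinctBlocking : Set
  DistinctBlocking = ∀ {x y} → x ≢ y → eG ends x y ≤ m → ∀ b → eG ends x y ≤ countF (λ a → adjH C (x , a) (y , b))

  Independent : VSubset n m → Set
  Independent I = ∀ x a y b → I x a ≡ true → I y b ≡ true → ((x == y) ∧ (a == b)) ≡ false →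
    adjH C (x , a) (y , b) ≡ false

  independent-sound : ∀ I → independent C I ≡ true → Independent I
  independent-sound I h x a y b Ixa Iyb distinct =
    unpair Ixa Iyb distinct (allF-true⁻ (allF-true⁻ (allF-true⁻ (allF-true⁻ h x) a) y) b)
    where
    unpair : ∀ {u w z t} → u ≡ true → w ≡ true → z ≡ false → not (u ∧ w ∧ not z ∧ t) ≡ true → t ≡ false
    unpair refl refl refl = not-injective

  independent-complete : ∀ I → Independent I → independent C I ≡ true
  independent-complete I ind = allF-true λ x → allF-true λ a → allF-true λ y → allF-true λ b →
    pair (I x a) (I y b) ((x == y) ∧ (a == b)) (adjH C (x , a) (y , b)) (ind x a y b)
    where
    pair : ∀ u w z t → (u ≡ true → w ≡ true → z ≡ false → t ≡ false) → not (u ∧ w ∧ not z ∧ t) ≡ true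
    pair false w     z     t h = refl
    pair true  false z     t h = refl
    pair true  true  true  t h = refl
    pair true  true  false t h rewrite h refl refl refl = refl

  NoConflicts : VSubset n m → Set
  NoConflicts I = ∀ {x y} → x ≢ y → ∀ {a b} → I x a ≡ true → I y b ≡ true → adjH C (x , a) (y , b) ≡ false

  Proper : VSubset n m → Set
  Proper I = (∀ x → countF (I x) ≡ 1) × NoConflicts I

  isColoring-cong : ∀ I I′ → (∀ x → I x ≡ I′ x) → isColoring C I ≡ isColoring C I′
  isColoring-cong I I′ eq =
    cong₂ _∧_ (cong (_≡ᵇ n) (sumF-cong (λ x → cong countF (eq x))))
              (allF-cong λ x → allF-cong λ a → allF-cong λ y → allF-cong λ b →
                cong₂ (λ u w → not (u ∧ w ∧ not ((x == y) ∧ (a == b)) ∧ adjH C (x , a) (y , b)))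
                      (cong (λ S → S a) (eq x)) (cong (λ S → S b) (eq y)))

  isColoring-sound : ∀ I → isColoring C I ≡ true → Proper I
  isColoring-sound I h = ones , λ x≢y Ixa Iyb → ind _ _ _ _ Ixa Iyb (cong (_∧ _) (==-false x≢y))
    where
    ind : Independent I
    ind = independent-sound I (∧-conicalʳ (size I ≡ᵇ n) _ h)
    one-colour : ∀ x a b → I x a ≡ true → I x b ≡ true → a ≡ b
    one-colour x a b Ixa Ixb with a ≟ b
    ... | yes a≡b = a≡b
    ... | no  a≢b with () ← trans (sym (adjH-same-vertex x a≢b))
                              (ind x a x b Ixa Ixb (trans (cong (_∧ (a == b)) (==-refl x)) (==-false a≢b)))
    ones : ∀ x → countF (I x) ≡ 1
    ones = sumF-≤1-saturated (λ x → countF (I x))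
             (λ x → ≤-trans (countF-unique (I x) (one-colour x)) (indicator≤1 _))
             (≡ᵇ⇒≡ _ _ (subst T (sym (∧-conicalˡ (size I ≡ᵇ n) _ h)) _))

  isColoring-complete : ∀ I → Proper I → isColoring C I ≡ true
  isColoring-complete I (ones , noConflicts) = ∧-true size≡n (independent-complete I ind)
    where
    size≡n : (size I ≡ᵇ n) ≡ true
    size≡n = Equivalence.to T-≡ (≡⇒≡ᵇ _ _ (trans (sumF-cong ones) (trans (sumF-const {n} 1) (*-identityʳ n))))
    ind : Independent I
    ind x a y b Ixa Iyb distinct = decide (x ≟ y)
      where
      decide : Dec (x ≡ y) → adjH C (x , a) (y , b) ≡ false
      decide (no  x≢y) = noConflicts x≢y Ixa Iyb
      decide (yes x≡y) = contradiction distinct (not-¬ (∧-true (==-true x≡y) (==-true a≡b)))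
        where
        a≡b : a ≡ b
        a≡b = countF≡1⇒unique (I x) (ones x) a b Ixa (subst (λ z → I z b ≡ true) (sym x≡y) Iyb)

module Ordered {n k} {ends : Ends n k} (π : Permutation′ n) {m} (C : FullCover ends m) where

  open Enumeration {Fin m → Bool} (λ _ → false) (allFuns m bools)

  vertex : Fin n → Fin n
  vertex j = π ⟨$⟩ʳ j

  vertex-injective : ∀ {i j} → vertex i ≡ vertex j → i ≡ j
  vertex-injective eq = trans (sym (inverseˡ π)) (trans (cong (π ⟨$⟩ˡ_) eq) (inverseˡ π))

  earlier-distinct : ∀ {i j} → toℕ i < toℕ j → vertex j ≢ vertex i
  earlier-distinct i<j eq = <-irrefl (cong toℕ (sym (vertex-injective eq))) i<j

  inOrder : (Fin n → Fin m → Bool) → VSubset n m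
  inOrder g x = g (π ⟨$⟩ˡ x)

  inOrder-vertex : ∀ g j → inOrder g (vertex j) ≡ g j
  inOrder-vertex g j = cong g (inverseˡ π)

  blocked : Fin n → (Fin n → Fin m → Bool) → Fin m → Bool
  blocked j g a = anyF (λ i → (toℕ i <ᵇ toℕ j) ∧ anyF (λ b → g i b ∧ adjH C (vertex j , a) (vertex i , b)))

  admissible : Fin n → (Fin n → Fin m → Bool) → Bool
  admissible j g = singletonIn (g j) (λ a → not (blocked j g a))

  blocked-true : ∀ {i j g a b} → toℕ i < toℕ j → g i b ≡ true → adjH C (vertex j , a) (vertex i , b) ≡ true →
    blocked j g a ≡ true
  blocked-true {i} {j} {g} {a} {b} i<j gib adj =
    anyF-true {p = λ i → (toℕ i <ᵇ toℕ j) ∧ anyF (λ b → g i b ∧ adjH C (vertex j , a) (vertex i , b))} i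
      (∧-true (<⇒<ᵇ≡true i<j) (anyF-true {p = λ b → g i b ∧ adjH C (vertex j , a) (vertex i , b)} b (∧-true gib adj)))

  blocked-true⁻ : ∀ {j g a} → blocked j g a ≡ true →
    ∃ λ i → toℕ i < toℕ j × ∃ λ b → g i b ≡ true × adjH C (vertex j , a) (vertex i , b) ≡ true
  blocked-true⁻ h with anyF-true⁻ h
  ... | i , hi with ∧-true⁻ hi
  ... | i<ᵇj , hb with anyF-true⁻ hb
  ... | b , hib = i , <ᵇ≡true⇒< i<ᵇj , b , ∧-true⁻ hib

  blocked-dependsOnEarlier : ∀ j g g′ → (∀ i → toℕ i < toℕ j → g i ≡ g′ i) →
    ∀ a → blocked j g a ≡ blocked j g′ a
  blocked-dependsOnEarlier j g g′ eq a = anyF-cong λ i → earlier i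
    where
    earlier : ∀ i → ((toℕ i <ᵇ toℕ j) ∧ anyF (λ b → g i b ∧ adjH C (vertex j , a) (vertex i , b)))
                  ≡ ((toℕ i <ᵇ toℕ j) ∧ anyF (λ b → g′ i b ∧ adjH C (vertex j , a) (vertex i , b)))
    earlier i with toℕ i <ᵇ toℕ j in i<ᵇj
    ... | false = refl
    ... | true  rewrite eq i (<ᵇ≡true⇒< i<ᵇj) = refl

  admissible-dependsOnPrefix : DependsOnPrefix admissible
  admissible-dependsOnPrefix j g g′ eq =
    singletonIn-cong (λ a → cong (λ S → S a) (eq j ≤-refl))
                     (λ a → cong not (blocked-dependsOnEarlier j g g′ (λ i i<j → eq i (<⇒≤ i<j)) a))

  admissible-no-conflict : ∀ {i j g a b} → admissible j g ≡ true → g j a ≡ true → toℕ i < toℕ j →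
    g i b ≡ true → adjH C (vertex j , a) (vertex i , b) ≡ false
  admissible-no-conflict {i} {j} {g} {a} {b} adm gja i<j gib with adjH C (vertex j , a) (vertex i , b) in adj
  ... | false = refl
  ... | true with () ← trans (sym (proj₂ (singletonIn-sound (g j) _ adm) a gja)) (cong not (blocked-true i<j gib adj))

  proper⇒admissible : ∀ g → Proper C (inOrder g) → ∀ j → admissible j g ≡ true
  proper⇒admissible g (ones , noConflicts) j =
    singletonIn-complete (g j) _ (subst (λ S → countF S ≡ 1) (inOrder-vertex g j) (ones (vertex j))) unblocked
    where
    unblocked : ∀ a → g j a ≡ true → not (blocked j g a) ≡ true
    unblocked a gja with blocked j g a in bl
    ... | false = refl
    ... | true with blocked-true⁻ bl
    ... | i , i<j , b , gib , adj with () ← trans (sym adj)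
          (noConflicts (earlier-distinct i<j) (trans (cong (λ S → S a) (inOrder-vertex g j)) gja)
                                              (trans (cong (λ S → S b) (inOrder-vertex g i)) gib))

  admissible⇒proper : ∀ g → (∀ j → admissible j g ≡ true) → Proper C (inOrder g)
  admissible⇒proper g adm = (λ x → proj₁ (singletonIn-sound (inOrder g x) _ (adm (π ⟨$⟩ˡ x)))) , noConflicts
    where
    later-no-conflict : ∀ {x y a b} → toℕ (π ⟨$⟩ˡ y) < toℕ (π ⟨$⟩ˡ x) →
      inOrder g x a ≡ true → inOrder g y b ≡ true → adjH C (x , a) (y , b) ≡ false
    later-no-conflict {x} {y} {a} {b} y<x gxa gyb =
      subst₂ (λ x′ y′ → adjH C (x′ , a) (y′ , b) ≡ false) (inverseʳ π) (inverseʳ π)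
        (admissible-no-conflict {i = π ⟨$⟩ˡ y} {j = π ⟨$⟩ˡ x} {g = g} (adm (π ⟨$⟩ˡ x)) gxa y<x gyb)
    noConflicts : NoConflicts C (inOrder g)
    noConflicts {x} {y} x≢y {a} {b} gxa gyb with <-cmp (toℕ (π ⟨$⟩ˡ x)) (toℕ (π ⟨$⟩ˡ y))
    ... | tri< x<y _ _ = trans (adjH-sym C x a y b) (later-no-conflict x<y gyb gxa)
    ... | tri≈ _ x≡y _ = ⊥-elim (x≢y (trans (sym (inverseʳ π)) (trans (cong vertex (toℕ-injective x≡y)) (inverseʳ π))))
    ... | tri> _ _ y<x = later-no-conflict y<x gxa gyb

  isColoring-inOrder : ∀ g → isColoring C (inOrder g) ≡ allHold admissible g
  isColoring-inOrder g = ⇔→≡ {z = true} (mk⇔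
    (λ col → allF-true (proper⇒admissible g (isColoring-sound C _ col)))
    (λ adm → isColoring-complete C _ (admissible⇒proper g (allF-true⁻ adm))))

  PDPcover≡countList-admissible : PDPcover C ≡ countList (allHold admissible) (allFuns n (allFuns m bools))
  PDPcover≡countList-admissible =
    trans (countList-allFuns-permute π (isColoring C) (isColoring-cong C))
          (countList-cong (allFuns n (allFuns m bools)) isColoring-inOrder)

  choicesAt-admissible : ∀ j g → choicesAt admissible j g ≡ m ∸ countF (blocked j g)
  choicesAt-admissible j g = begin
    countList (λ S → admissible j (set g j S)) (allFuns m bools)
      ≡⟨ countList-cong (allFuns m bools) (λ S → singletonIn-cong (λ a → cong (λ T → T a) (updateAt-updates j g))
           (λ a → cong not (blocked-dependsOnEarlier j (set g j S) g (λ i i<j → updateAt-minimal i j g (earlier-≢ i<j)) a))) ⟩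
    countList (λ S → singletonIn S (λ a → not (blocked j g a))) (allFuns m bools)
      ≡⟨ countList-singletonIn m _ ⟩
    countF (λ a → not (blocked j g a))
      ≡⟨ countF-complement (blocked j g) ⟩
    m ∸ countF (blocked j g) ∎
    where
    open ≡-Reasoning
    earlier-≢ : ∀ {i} → toℕ i < toℕ j → i ≢ j
    earlier-≢ i<j i≡j = <-irrefl (cong toℕ i≡j) i<j

  backEdge : Fin n → Fin k → Fin n → Bool
  backEdge j e i = (toℕ i <ᵇ toℕ j) ∧ joins (ends e) (vertex j) (vertex i)

  backEdge-earlier : ∀ j e i → backEdge j e i ≡ true → toℕ i < toℕ j
  backEdge-earlier j e i h = <ᵇ≡true⇒< (proj₁ (∧-true⁻ {toℕ i <ᵇ toℕ j} h))

  backEdge-joins : ∀ j e i → backEdge j e i ≡ true → joins (ends e) (vertex j) (vertex i) ≡ true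
  backEdge-joins j e i h = proj₂ (∧-true⁻ {toℕ i <ᵇ toℕ j} h)

  countF-blockedBy≤eG : ∀ j (g : Fin n → Fin m → Bool) i → toℕ i < toℕ j → countF (g i) ≤ 1 →
    countF (λ a → anyF (λ b → g i b ∧ adjH C (vertex j , a) (vertex i , b))) ≤ eG ends (vertex j) (vertex i)
  countF-blockedBy≤eG j g i i<j ≤1 = begin
    countF (λ a → anyF (λ b → g i b ∧ adjH C (vertex j , a) (vertex i , b)))
      ≤⟨ countF-union (λ b a → g i b ∧ adjH C (vertex j , a) (vertex i , b)) ⟩
    sumF (λ b → countF (λ a → g i b ∧ adjH C (vertex j , a) (vertex i , b)))
      ≤⟨ sumF-mono per-colour ⟩
    sumF (λ b → indicator (g i b) * eG ends (vertex j) (vertex i))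
      ≡⟨ sumF-*ʳ (indicator ∘′ g i) _ ⟩
    countF (g i) * eG ends (vertex j) (vertex i)
      ≤⟨ *-monoˡ-≤ _ ≤1 ⟩
    1 * eG ends (vertex j) (vertex i)
      ≡⟨ *-identityˡ _ ⟩
    eG ends (vertex j) (vertex i) ∎
    where
    open ≤-Reasoning
    per-colour : ∀ b → countF (λ a → g i b ∧ adjH C (vertex j , a) (vertex i , b))
                       ≤ indicator (g i b) * eG ends (vertex j) (vertex i)
    per-colour b with g i b
    ... | false = ≤-reflexive (sumF-zero {m})
    ... | true  = ≤-trans (adjH-neighbours≤eG C (earlier-distinct i<j) b) (≤-reflexive (sym (+-identityʳ _)))

  countF-blocked≤dBack : ∀ j g → (∀ i → toℕ i < toℕ j → countF (g i) ≤ 1) → countF (blocked j g) ≤ dBack ends π j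
  countF-blocked≤dBack j g ≤1 = begin
    countF (blocked j g)
      ≤⟨ countF-union (λ i a → (toℕ i <ᵇ toℕ j) ∧ anyF (λ b → g i b ∧ adjH C (vertex j , a) (vertex i , b))) ⟩
    sumF (λ i → countF (λ a → (toℕ i <ᵇ toℕ j) ∧ anyF (λ b → g i b ∧ adjH C (vertex j , a) (vertex i , b))))
      ≤⟨ sumF-mono blockedBy≤backEdges ⟩
    sumF (λ i → countF (λ e → backEdge j e i))
      ≡⟨ sumF-swap (λ i e → indicator (backEdge j e i)) ⟩
    sumF (λ e → countF (backEdge j e))
      ≤⟨ sumF-mono (λ e → countF-unique (backEdge j e) (other-end-unique e)) ⟩
    dBack ends π j ∎
    where
    open ≤-Reasoning
    other-end-unique : ∀ e i i′ → backEdge j e i ≡ true → backEdge j e i′ ≡ true → i ≡ i′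
    other-end-unique e i i′ h h′ = vertex-injective
      (joins-other-end-unique (ends e) (vertex j) (vertex i) (vertex i′) (backEdge-joins j e i h) (backEdge-joins j e i′ h′)
                              (earlier-distinct (backEdge-earlier j e i h)) (earlier-distinct (backEdge-earlier j e i′ h′)))
    blockedBy≤backEdges : ∀ i →
      countF (λ a → (toℕ i <ᵇ toℕ j) ∧ anyF (λ b → g i b ∧ adjH C (vertex j , a) (vertex i , b)))
        ≤ countF (λ e → backEdge j e i)
    blockedBy≤backEdges i with toℕ i <ᵇ toℕ j in i<ᵇj
    ... | false = ≤-trans (≤-reflexive (sumF-zero {m})) z≤n
    ... | true  = countF-blockedBy≤eG j g i (<ᵇ≡true⇒< i<ᵇj) (≤1 i (<ᵇ≡true⇒< i<ᵇj))

  prod≤PDPcover : prodF (λ j → m ∸ dBack ends π j) ≤ PDPcover C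
  prod≤PDPcover = ≤-trans (prod≤countList-allHold admissible _ admissible-dependsOnPrefix choices)
                          (≤-reflexive (sym PDPcover≡countList-admissible))
    where
    choices : ∀ j g → EarlierHold admissible j g → m ∸ dBack ends π j ≤ choicesAt admissible j g
    choices j g earlier = ≤-trans (∸-monoʳ-≤ m (countF-blocked≤dBack j g λ i i<j →
                                     ≤-reflexive (proj₁ (singletonIn-sound (g i) _ (earlier i i<j)))))
                                  (≤-reflexive (sym (choicesAt-admissible j g)))

  module _ (oneBack : AtMostOnePrecedingNbr ends π) (D≤m : maxF (dBack ends π) ≤ m) (blocking : DistinctBlocking C) where

    backEdges-share-target : ∀ j e e′ i i′ → backEdge j e i ≡ true → backEdge j e′ i′ ≡ true → i ≡ i′
    backEdges-share-target j e e′ i i′ h h′ = oneBack j i i′ (backEdge-earlier j e i h) (backEdge-earlier j e′ i′ h′)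
      (e  , trans (joins-sym (ends e) _ _) (backEdge-joins j e i h))
      (e′ , trans (joins-sym (ends e′) _ _) (backEdge-joins j e′ i′ h′))

    dBack≤countF-blocked : ∀ j g → EarlierHold admissible j g → dBack ends π j ≤ countF (blocked j g)
    dBack≤countF-blocked j g earlier with dBack ends π j in dBack≡
    ... | zero  = z≤n
    ... | suc _ with countF≡suc⇒∃ (λ e → anyF (backEdge j e)) dBack≡
    ... | e₀ , back₀ with anyF-true⁻ {p = backEdge j e₀} back₀
    ... | p , p-back = ≤-trans (≤-reflexive (sym dBack≡)) (begin
      dBack ends π j                                          ≤⟨ countF-mono {p = λ e → anyF (backEdge j e)} all-to-p ⟩
      eG ends (vertex j) (vertex p)                          ≤⟨ blocking (earlier-distinct p<j) eG≤m b₀ ⟩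
      countF (λ a → adjH C (vertex j , a) (vertex p , b₀))
        ≤⟨ countF-mono {q = blocked j g} (λ a → blocked-true {g = g} p<j gpb₀) ⟩
      countF (blocked j g)                                    ∎)
      where
      open ≤-Reasoning
      p<j : toℕ p < toℕ j
      p<j = backEdge-earlier j e₀ p p-back
      all-to-p : ∀ e → anyF (backEdge j e) ≡ true → joins (ends e) (vertex j) (vertex p) ≡ true
      all-to-p e back with anyF-true⁻ {p = backEdge j e} back
      ... | i , i-back = subst (λ z → joins (ends e) (vertex j) (vertex z) ≡ true)
                               (backEdges-share-target j e e₀ i p i-back p-back) (backEdge-joins j e i i-back)
      eG≤m : eG ends (vertex j) (vertex p) ≤ m
      eG≤m = begin
        eG ends (vertex j) (vertex p)
          ≤⟨ countF-mono {q = λ e → anyF (backEdge j e)} (λ e jp → anyF-true p (∧-true (<⇒<ᵇ≡true p<j) jp)) ⟩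
        dBack ends π j                 ≤⟨ maxF-upper (dBack ends π) j ⟩
        maxF (dBack ends π)            ≤⟨ D≤m ⟩
        m                              ∎
      b₀-exists : ∃ λ b → g p b ≡ true
      b₀-exists = countF≡suc⇒∃ (g p) (proj₁ (singletonIn-sound (g p) _ (earlier p p<j)))
      b₀ : Fin m
      b₀ = proj₁ b₀-exists
      gpb₀ : g p b₀ ≡ true
      gpb₀ = proj₂ b₀-exists

    PDPcover≤prod : PDPcover C ≤ prodF (λ j → m ∸ dBack ends π j)
    PDPcover≤prod = ≤-trans (≤-reflexive PDPcover≡countList-admissible)
                            (countList-allHold≤prod admissible _ admissible-dependsOnPrefix choices)
      where
      choices : ∀ j g → EarlierHold admissible j g → choicesAt admissible j g ≤ m ∸ dBack ends π j
      choices j g earlier = ≤-trans (≤-reflexive (choicesAt-admissible j g))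
                                    (∸-monoʳ-≤ m (dBack≤countF-blocked j g earlier))

-- A cover in which parallel edges block distinct colours

-- For s < 2m and t < m, Wraps m s t says s ≡ t (mod m).
Wraps : ℕ → ℕ → ℕ → Set
Wraps m s t = s ≡ t ⊎ s ≡ t + m

≡+-≮ : ∀ {s t m} → s ≡ t + m → ¬ s < m
≡+-≮ {t = t} {m} eq s<m = <⇒≱ s<m (subst (m ≤_) (sym eq) (m≤n+m m t))

wraps-cancelˡ : ∀ {m} a {b b′ t} → b < m → b′ < m → Wraps m (a + b) t → Wraps m (a + b′) t → b ≡ b′
wraps-cancelˡ a b<m b′<m (inj₁ p) (inj₁ q) = +-cancelˡ-≡ a _ _ (trans p (sym q))
wraps-cancelˡ a b<m b′<m (inj₂ p) (inj₂ q) = +-cancelˡ-≡ a _ _ (trans p (sym q))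
wraps-cancelˡ {m} a {b} {b′} b<m b′<m (inj₁ p) (inj₂ q) =
  ⊥-elim (≡+-≮ (+-cancelˡ-≡ a _ _ (trans q (trans (cong (_+ m) (sym p)) (+-assoc a b m)))) b′<m)
wraps-cancelˡ {m} a {b} {b′} b<m b′<m (inj₂ p) (inj₁ q) =
  ⊥-elim (≡+-≮ (+-cancelˡ-≡ a _ _ (trans p (trans (cong (_+ m) (sym q)) (+-assoc a b′ m)))) b<m)

wraps-target : ∀ {m s t t′} → t < m → t′ < m → Wraps m s t → Wraps m s t′ → t ≡ t′
wraps-target t<m t′<m (inj₁ p) (inj₁ q) = trans (sym p) q
wraps-target t<m t′<m (inj₂ p) (inj₂ q) = +-cancelʳ-≡ _ _ _ (trans (sym p) q)
wraps-target t<m t′<m (inj₁ p) (inj₂ q) = ⊥-elim (≡+-≮ (trans (sym p) q) t<m)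
wraps-target t<m t′<m (inj₂ p) (inj₁ q) = ⊥-elim (≡+-≮ (trans (sym q) p) t′<m)

wraps-solve : ∀ {m} a t → a < m → t < m → ∃ λ c → c < m × Wraps m (a + c) t
wraps-solve {m} a t a<m t<m with a ≤? t
... | yes a≤t = t ∸ a , ≤-<-trans (m∸n≤m t a) t<m , inj₁ (m+[n∸m]≡n a≤t)
... | no  a≰t = t + m ∸ a , c<m , inj₂ (m+[n∸m]≡n (≤-trans (<⇒≤ a<m) (m≤n+m m t)))
  where
  c<m : t + m ∸ a < m
  c<m = +-cancelʳ-< a _ m (subst (_< m + a) (sym (trans (+-comm _ a) (m+[n∸m]≡n (≤-trans (<⇒≤ a<m) (m≤n+m m t)))))
          (subst (_< m + a) (+-comm m t) (+-monoʳ-< m (≰⇒> a≰t))))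

module ReflectionCover {n k} (ends : Ends n k) (m′ : ℕ) where

  m : ℕ
  m = suc m′

  rank : Fin k → ℕ
  rank e = countF (λ e′ → (toℕ e′ <ᵇ toℕ e) ∧ joins (ends e′) (proj₁ (ends e)) (proj₂ (ends e)))

  offset : Fin k → ℕ
  offset e = rank e % m

  offset<m : ∀ e → offset e < m
  offset<m e = m%n<n (rank e) m

  reflects : Fin k → Fin m → Fin m → Bool
  reflects e a b = (toℕ a + toℕ b ≡ᵇ offset e) ∨ (toℕ a + toℕ b ≡ᵇ offset e + m)

  reflects-true⁻ : ∀ e a b → reflects e a b ≡ true → Wraps m (toℕ a + toℕ b) (offset e)
  reflects-true⁻ e a b h with toℕ a + toℕ b ≡ᵇ offset e in direct
  ... | true  = inj₁ (≡ᵇ⇒≡ _ _ (subst T (sym direct) _))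
  ... | false = inj₂ (≡ᵇ⇒≡ _ _ (subst T (sym h) _))

  reflects-true : ∀ e a b → Wraps m (toℕ a + toℕ b) (offset e) → reflects e a b ≡ true
  reflects-true e a b (inj₁ p) rewrite Equivalence.to T-≡ (≡⇒≡ᵇ _ _ p) = refl
  reflects-true e a b (inj₂ p) rewrite Equivalence.to T-≡ (≡⇒≡ᵇ _ _ p) = ∨-zeroʳ _

  partner : ∀ e (a : Fin m) → ∃ λ c → reflects e a c ≡ true
  partner e a with wraps-solve (toℕ a) (offset e) (toℕ<n a) (offset<m e)
  ... | c , c<m , wraps =
    fromℕ< c<m , reflects-true e a _ (subst (λ z → Wraps m (toℕ a + z) (offset e)) (sym (toℕ-fromℕ< c<m)) wraps)

  reflects-matchingˡ : ∀ e a b b′ → reflects e a b ≡ true → reflects e a b′ ≡ true → b ≡ b′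
  reflects-matchingˡ e a b b′ h h′ =
    toℕ-injective (wraps-cancelˡ (toℕ a) (toℕ<n b) (toℕ<n b′) (reflects-true⁻ e a b h) (reflects-true⁻ e a b′ h′))

  reflects-sym : ∀ e a b → reflects e a b ≡ true → reflects e b a ≡ true
  reflects-sym e a b h =
    reflects-true e b a (subst (λ s → Wraps m s (offset e)) (+-comm (toℕ a) (toℕ b)) (reflects-true⁻ e a b h))

  reflects-matchingʳ : ∀ e a a′ b → reflects e a b ≡ true → reflects e a′ b ≡ true → a ≡ a′
  reflects-matchingʳ e a a′ b h h′ = reflects-matchingˡ e b a a′ (reflects-sym e a b h) (reflects-sym e a′ b h′)

  reflects-row : ∀ e a → countF (reflects e a) ≡ 1
  reflects-row e a = ≤-antisym (countF≤1 _ (reflects-matchingˡ e a)) (countF-member (reflects e a) _ (proj₂ (partner e a)))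

  cover : FullCover ends m
  cover = record
    { M = reflects
    ; matchingˡ = reflects-matchingˡ
    ; matchingʳ = reflects-matchingʳ
    ; full = λ u w _ → trans (sumF-cong (edge-total u w)) (sumF-*ʳ (λ e → indicator (joins (ends e) u w)) m)
    }
    where
    edge-total : ∀ u w e → (if joins (ends e) u w then sumF (λ a → countF (reflects e a)) else 0)
                           ≡ indicator (joins (ends e) u w) * m
    edge-total u w e with joins (ends e) u w
    ... | false = refl
    ... | true  = trans (sumF-cong (reflects-row e)) (trans (sumF-const {m} 1) (trans (*-identityʳ m) (sym (+-identityʳ m))))

  module _ {x y : Fin n} where

    between : Fin k → Bool
    between e = joins (ends e) x y

    rank-between : ∀ e → between e ≡ true → rank e ≡ countF (λ e′ → (toℕ e′ <ᵇ toℕ e) ∧ between e′)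
    rank-between e je = countF-cong λ e′ → cong ((toℕ e′ <ᵇ toℕ e) ∧_) (joins-endpoints (ends e′) (ends e) x y je)

    rank<eG : ∀ e → between e ≡ true → rank e < eG ends x y
    rank<eG e je = subst (_< eG ends x y) (sym (rank-between e je))
      (countF-strict (λ e′ h → proj₂ (∧-true⁻ h)) e je (cong (_∧ between e) (<ᵇ-irrefl (toℕ e))))

    rank-strictMono : ∀ e e′ → between e ≡ true → between e′ ≡ true → toℕ e < toℕ e′ → rank e < rank e′
    rank-strictMono e e′ je je′ e<e′ = subst₂ _<_ (sym (rank-between e je)) (sym (rank-between e′ je′))
      (countF-strict (λ e″ h → ∧-true (<⇒<ᵇ≡true (<-trans (<ᵇ≡true⇒< (proj₁ (∧-true⁻ h))) e<e′)) (proj₂ (∧-true⁻ h)))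
                     e (∧-true (<⇒<ᵇ≡true e<e′) je) (cong (_∧ between e) (<ᵇ-irrefl (toℕ e))))

    offset≡rank : eG ends x y ≤ m → ∀ e → between e ≡ true → offset e ≡ rank e
    offset≡rank eG≤m e je = m<n⇒m%n≡m (<-≤-trans (rank<eG e je) eG≤m)

    offset-injective : eG ends x y ≤ m → ∀ e e′ → between e ≡ true → between e′ ≡ true →
      offset e ≡ offset e′ → e ≡ e′
    offset-injective eG≤m e e′ je je′ eq with <-cmp (toℕ e) (toℕ e′)
    ... | tri< e<e′ _ _ = ⊥-elim (<-irrefl rank-eq (rank-strictMono e e′ je je′ e<e′))
      where
      rank-eq : rank e ≡ rank e′
      rank-eq = trans (sym (offset≡rank eG≤m e je)) (trans eq (offset≡rank eG≤m e′ je′))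
    ... | tri≈ _ e≡e′ _ = toℕ-injective e≡e′
    ... | tri> _ _ e′<e = ⊥-elim (<-irrefl rank-eq (rank-strictMono e′ e je′ je e′<e))
      where
      rank-eq : rank e′ ≡ rank e
      rank-eq = trans (sym (offset≡rank eG≤m e′ je′)) (trans (sym eq) (offset≡rank eG≤m e je))

  cover-distinctBlocking : DistinctBlocking cover
  cover-distinctBlocking {x} {y} x≢y eG≤m b₀ =
    countF-injection {p = between {x} {y}} {q = λ a → adjH cover (x , a) (y , b₀)}
                     colour colour-blocks colour-injective
    where
    colour : Fin k → Fin m
    colour e = proj₁ (partner e b₀)
    colour-wraps : ∀ e → Wraps m (toℕ b₀ + toℕ (colour e)) (offset e)
    colour-wraps e = reflects-true⁻ e b₀ (colour e) (proj₂ (partner e b₀))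
    colour-injective : ∀ e e′ → joins (ends e) x y ≡ true → joins (ends e′) x y ≡ true → colour e ≡ colour e′ → e ≡ e′
    colour-injective e e′ je je′ eq = offset-injective eG≤m e e′ je je′
      (wraps-target (offset<m e) (offset<m e′) (colour-wraps e)
                    (subst (λ c → Wraps m (toℕ b₀ + toℕ c) (offset e′)) (sym eq) (colour-wraps e′)))
    either-orientation : ∀ o₁ o₂ {r₁ r₂} → o₁ ∨ o₂ ≡ true → r₁ ≡ true → r₂ ≡ true →
      (o₁ ∧ r₁ ∨ o₂ ∧ r₂) ≡ true
    either-orientation true  o₂    _ refl _    = refl
    either-orientation false true  _ _    refl = refl
    colour-blocks : ∀ e → joins (ends e) x y ≡ true → adjH cover (x , colour e) (y , b₀) ≡ true
    colour-blocks e je rewrite ==-false x≢y =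
      anyF-true {p = λ e′ → ((proj₁ (ends e′) == x) ∧ (proj₂ (ends e′) == y)) ∧ reflects e′ (colour e) b₀
                          ∨ ((proj₁ (ends e′) == y) ∧ (proj₂ (ends e′) == x)) ∧ reflects e′ b₀ (colour e)}
        e (either-orientation ((proj₁ (ends e) == x) ∧ (proj₂ (ends e) == y)) _ je
                              (reflects-sym e b₀ (colour e) (proj₂ (partner e b₀))) (proj₂ (partner e b₀)))

distinctBlockingCover : ∀ {n k} (ends : Ends n k) m → Σ (FullCover ends m) DistinctBlocking
distinctBlockingCover {k = k} ends zero = trivial , λ _ _ ()
  where
  trivial : FullCover ends 0
  trivial = record
    { M = λ _ ()
    ; matchingˡ = λ _ ()
    ; matchingʳ = λ _ ()
    ; full = λ u w _ → trans (sumF-cong (λ e → if-same (joins (ends e) u w))) (trans (sumF-zero {k}) (sym (*-zeroʳ (eG ends u w))))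
    }
    where
    if-same : ∀ b → (if b then 0 else 0) ≡ 0
    if-same true  = refl
    if-same false = refl
distinctBlockingCover ends (suc m′) = cover , cover-distinctBlocking
  where open ReflectionCover ends m′

proposition11 : (n k : ℕ) (ends : Ends n k) → Loopless ends → 2 ≤ n →
    UnderlyingTree ends →
    (π : Permutation′ n) → AtMostOnePrecedingNbr ends π →
    (m : ℕ) → maxF (dBack ends π) ≤ m →
    PDPis ends m (prodF (λ j → m ∸ dBack ends π j))
proposition11 n k ends _ _ _ π oneBack m D≤m with distinctBlockingCover ends m
... | C⋆ , blocking =
  (C⋆ , ≤-antisym (Ordered.PDPcover≤prod π C⋆ oneBack D≤m blocking) (Ordered.prod≤PDPcover π C⋆)) ,
  Ordered.prod≤PDPcover π
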